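{- Let $k\geq 3$, $1<t<k$, and $1\le d<t$ with $t+d\le k$ and $k$ odd, $t$ even, $d$ even. Let $x\in\{0,1\}^k$ have weight $d$. Then there is an odd $m$ such that $\mathrm{Pol}(\mathbf{I}_{t,k}\cup\{x\},\mathbf{NAE}_k)$ contains no 2-block-symmetric function of arity $m$.
   Context: Weight of a Boolean tuple = number of 1's. $\mathbf{I}_{t,k}\cup\{x\}$: Boolean structure whose single $k$-ary relation is the set of all tuples of weight $t$ together with $x$. $\mathbf{NAE}_k$: Boolean structure with relation $\{0,1\}^k\setminus\{0^k,1^k\}$. A polymorphism of arity $m$ of $(\mathbf{A},\mathbf{B})$ (single $k$-ary relations $R,S$) is $f:\{0,1\}^m\to\{0,1\}$ such that for every $k\times m$ matrix with columns in $R$, applying $f$ row-wise gives a tuple in $S$. A function of arity $2n+1$ is 2-block-symmetric if it is invariant under every permutation of its coordinates that preserves parity of positions. -}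

module Defs where

open import Data.Nat using (ℕ; zero; suc; _+_; _*_; _%_)
open import Data.Bool using (Bool; true; false)
open import Data.Fin using (Fin; toℕ)
open import Data.Vec using (Vec; []; _∷_; lookup; map; tabulate; replicate)
open import Data.Vec.Relation.Unary.All using (All)
open import Data.Fin.Permutation using (Permutation′; _⟨$⟩ʳ_)
open import Relation.Binary.PropositionalEquality using (_≡_)
open import Data.Sum using (_⊎_)
open import Data.Product using (_×_)
open import Relation.Nullary using (¬_)

Tuple : ℕ → Set
Tuple k = Vec Bool k

Rel : ℕ → Set₁
Rel k = Tuple k → Set

weight : ∀ {k} → Tuple k → ℕ
weight [] = 0
weight (true ∷ v) = suc (weight v)
weight (false ∷ v) = weight v

I∪ : (k t : ℕ) → Tuple k → Rel k
I∪ k t x y = (weight y ≡ t) ⊎ (y ≡ x)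

NAE : (k : ℕ) → Rel k
NAE k y = ¬ (y ≡ replicate k false) × ¬ (y ≡ replicate k true)

applyRows : ∀ {k m} → (Vec Bool m → Bool) → Vec (Tuple k) m → Tuple k
applyRows f cols = tabulate (λ i → f (map (λ c → lookup c i) cols))

IsPolymorphism : ∀ {k} (R S : Rel k) (m : ℕ) → (Vec Bool m → Bool) → Set
IsPolymorphism R S m f = (cols : Vec (Tuple _ ) m) → All R cols → S (applyRows f cols)

permute : ∀ {m} → Permutation′ m → Vec Bool m → Vec Bool m
permute π v = tabulate (λ i → lookup v (π ⟨$⟩ʳ i))

Is2BlockSymmetric : (n : ℕ) → (Vec Bool (suc (2 * n)) → Bool) → Set
Is2BlockSymmetric n f =
  (π : Permutation′ (suc (2 * n))) →
  (∀ i → toℕ (π ⟨$⟩ʳ i) % 2 ≡ toℕ i % 2) →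
  ∀ v → f (permute π v) ≡ f v

-- A 2-block-symmetric function of arity 2n + 1 depends only on the numbers of
-- ones in the even and in the odd positions of its argument (its parity
-- weights): vectors with equal parity weights are connected by
-- parity-preserving transpositions.  Take n = k(t + 1) and u = t(t + 1).
-- Interleaving n + 1 columns of I_{t,k} ∪ {x} with n weight-t columns whose
-- rows all have weight u, we build three matrices whose rows have parity
-- weights in {(u + t, u), (u, u)}, in {(t², u), (u, u)} and in
-- {(u + t, u), (t², u)}.  A polymorphism into NAE_k is not constant on the
-- rows of such a matrix, so a 2-block-symmetric one would take three pairwise
-- distinct Boolean values at (u + t, u), (u, u) and (t², u).  The columns are
-- obtained by laying out the prescribed row weights cyclically.

module Submission where

open import Defs
open import Data.Nat.Properties
open import Algebra.Properties.CommutativeMonoid.Sum +-0-commutativeMonoid using (sum-syntax; ∑-distrib-+; sum-cong-≗)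
open import Algebra.Properties.CommutativeSemigroup +-commutativeSemigroup using (x∙yz≈y∙xz)
open import Algebra.Properties.Semiring.Sum +-*-semiring using (*-distribˡ-sum)
open import Data.Bool using (Bool; true; false; not; _∧_; _∨_; if_then_else_; T)
open import Data.Bool.Base using (b≤b; f≤t) renaming (_≤_ to _≤𝔹_)
open import Data.Bool.Properties using (≤-minimum)
open import Data.Empty using (⊥; ⊥-elim)
open import Data.Fin using (Fin; toℕ; zero; suc)
open import Data.Fin.Permutation using (Permutation′; _⟨$⟩ʳ_; lift₀; transpose)
open import Data.Nat using (ℕ; zero; suc; _+_; _*_; _∸_; _%_; _≤_; _<_; _<ᵇ_; z≤n; s≤s; NonZero; >-nonZero)
open import Data.Nat.DivMod using (m<n⇒m%n≡m; [m+kn]%n≡m%n; m*n%n≡0)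
open import Data.Nat.Divisibility using (_∣_; ∣-refl; ∣m∣n⇒∣m+n; _∣0)
open import Data.Nat.Tactic.RingSolver using (solve-∀)
open import Data.Product using (Σ; ∃; ∃₂; _×_; _,_)
import Data.Product as Product
open import Data.Product.Properties using (,-injective; ,-injectiveˡ; ,-injectiveʳ)
open import Data.Sum using (_⊎_; inj₁; inj₂)
open import Data.Unit using (tt)
open import Data.Vec using (Vec; []; _∷_; lookup; map; tabulate; replicate; _++_)
open import Data.Vec.Properties
  using (lookup∘tabulate; tabulate∘lookup; tabulate-∘; tabulate-cong; lookup-map; map-++; map-replicate; lookup-replicate)
open import Data.Vec.Relation.Unary.All using (All; []; _∷_)
import Data.Vec.Relation.Unary.All as All
open import Data.Vec.Relation.Unary.All.Properties using (lookup⁻; ++⁺)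
open import Function using (_∘_)
open import Relation.Binary.Construct.Closure.Equivalence using (EqClosure; symmetric; gmap; gfold; return)
open import Relation.Binary.Construct.Closure.ReflexiveTransitive using (ε; _◅◅_)
open import Relation.Binary.PropositionalEquality
open import Relation.Binary.PropositionalEquality.Properties using (subst-application′)
open import Relation.Nullary using (¬_)

-- Block-symmetric functions depend only on parity weights

bit : Bool → ℕ
bit false = 0
bit true  = 1

mutual
  evenWeight : ∀ {m} → Vec Bool m → ℕ
  evenWeight []      = 0
  evenWeight (b ∷ v) = bit b + oddWeight v

  oddWeight : ∀ {m} → Vec Bool m → ℕ
  oddWeight []      = 0
  oddWeight (b ∷ v) = evenWeight v

parityWeights : ∀ {m} → Vec Bool m → ℕ × ℕ
parityWeights v = evenWeight v , oddWeight v

parityWeights-cancel₂ : ∀ {m} a b (v w : Vec Bool m) →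
  parityWeights (a ∷ b ∷ v) ≡ parityWeights (a ∷ b ∷ w) → parityWeights v ≡ parityWeights w
parityWeights-cancel₂ a b v w eq with ,-injective eq
... | eqₑ , eqₒ = cong₂ _,_ (+-cancelˡ-≡ (bit a) _ _ eqₑ) (+-cancelˡ-≡ (bit b) _ _ eqₒ)

IsBlockSymmetric : (m : ℕ) → (Vec Bool m → Bool) → Set
IsBlockSymmetric m f =
  (π : Permutation′ m) → (∀ i → toℕ (π ⟨$⟩ʳ i) % 2 ≡ toℕ i % 2) → ∀ v → f (permute π v) ≡ f v

data ParitySwap : ∀ {m} → Vec Bool m → Vec Bool m → Set where
  swap₀₂ : ∀ {m} a b c (v : Vec Bool m) → ParitySwap (a ∷ b ∷ c ∷ v) (c ∷ b ∷ a ∷ v)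
  swap₁₃ : ∀ {m} a b c d (v : Vec Bool m) → ParitySwap (a ∷ b ∷ c ∷ d ∷ v) (a ∷ d ∷ c ∷ b ∷ v)
  skip₂  : ∀ {m} a b {v w : Vec Bool m} → ParitySwap v w → ParitySwap (a ∷ b ∷ v) (a ∷ b ∷ w)

infix 4 _≈ₚ_
_≈ₚ_ : ∀ {m} → Vec Bool m → Vec Bool m → Set
_≈ₚ_ = EqClosure ParitySwap

≈ₚ-skip₂ : ∀ {m} a b {v w : Vec Bool m} → v ≈ₚ w → a ∷ b ∷ v ≈ₚ a ∷ b ∷ w
≈ₚ-skip₂ a b = gmap (λ v → a ∷ b ∷ v) (skip₂ a b)

paritySwap-parityWeights : ∀ {m} {v w : Vec Bool m} → ParitySwap v w → parityWeights v ≡ parityWeights w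
paritySwap-parityWeights (swap₀₂ a b c v) =
  cong (_, bit b + evenWeight v) (x∙yz≈y∙xz (bit a) (bit c) (oddWeight v))
paritySwap-parityWeights (swap₁₃ a b c d v) =
  cong (bit a + (bit c + evenWeight v) ,_) (x∙yz≈y∙xz (bit b) (bit d) (oddWeight v))
paritySwap-parityWeights (skip₂ a b s) = cong (Product.map (bit a +_) (bit b +_)) (paritySwap-parityWeights s)

≈ₚ-parityWeights : ∀ {m} {v w : Vec Bool m} → v ≈ₚ w → parityWeights v ≡ parityWeights w
≈ₚ-parityWeights = gfold isEquivalence parityWeights paritySwap-parityWeights

blockSymmetric-tail₂ : ∀ {m} {f : Vec Bool (suc (suc m)) → Bool} a b →
  IsBlockSymmetric (suc (suc m)) f → IsBlockSymmetric m (λ v → f (a ∷ b ∷ v))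
blockSymmetric-tail₂ a b sym-f π π-parity v = sym-f (lift₀ (lift₀ π)) lifted-parity (a ∷ b ∷ v)
  where
  lifted-parity : ∀ i → toℕ (lift₀ (lift₀ π) ⟨$⟩ʳ i) % 2 ≡ toℕ i % 2
  lifted-parity zero          = refl
  lifted-parity (suc zero)    = refl
  lifted-parity (suc (suc i)) = π-parity i

blockSymmetric-paritySwap : ∀ {m} {f : Vec Bool m → Bool} → IsBlockSymmetric m f →
  ∀ {v w} → ParitySwap v w → f v ≡ f w
blockSymmetric-paritySwap {f = f} sym-f (swap₀₂ a b c v) =
  trans (sym (sym-f (transpose zero (suc (suc zero))) parity (a ∷ b ∷ c ∷ v)))
        (cong (λ r → f (c ∷ b ∷ a ∷ r)) (tabulate∘lookup v))
  where
  parity : ∀ i → toℕ (transpose zero (suc (suc zero)) ⟨$⟩ʳ i) % 2 ≡ toℕ i % 2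
  parity zero                = refl
  parity (suc zero)          = refl
  parity (suc (suc zero))    = refl
  parity (suc (suc (suc i))) = refl
blockSymmetric-paritySwap {f = f} sym-f (swap₁₃ a b c d v) =
  trans (sym (sym-f (transpose (suc zero) (suc (suc (suc zero)))) parity (a ∷ b ∷ c ∷ d ∷ v)))
        (cong (λ r → f (a ∷ d ∷ c ∷ b ∷ r)) (tabulate∘lookup v))
  where
  parity : ∀ i → toℕ (transpose (suc zero) (suc (suc (suc zero))) ⟨$⟩ʳ i) % 2 ≡ toℕ i % 2
  parity zero                      = refl
  parity (suc zero)                = refl
  parity (suc (suc zero))          = refl
  parity (suc (suc (suc zero)))    = refl
  parity (suc (suc (suc (suc i)))) = refl
blockSymmetric-paritySwap sym-f (skip₂ a b s) = blockSymmetric-paritySwap (blockSymmetric-tail₂ a b sym-f) s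

blockSymmetric-≈ₚ : ∀ {m} {f : Vec Bool m → Bool} → IsBlockSymmetric m f → ∀ {v w} → v ≈ₚ w → f v ≡ f w
blockSymmetric-≈ₚ {f = f} sym-f = gfold isEquivalence f (blockSymmetric-paritySwap sym-f)

≈ₚ-evenOneToFront : ∀ {m a} (v : Vec Bool (suc m)) → evenWeight v ≡ suc a → ∃ λ w → v ≈ₚ true ∷ w
≈ₚ-evenOneToFront (true ∷ w) _ = w , ε
≈ₚ-evenOneToFront (false ∷ o ∷ v@(_ ∷ _)) eq with ≈ₚ-evenOneToFront v eq
... | w , v≈ = o ∷ false ∷ w , ≈ₚ-skip₂ false o v≈ ◅◅ return (swap₀₂ false o true w)

≈ₚ-oddOneToFront : ∀ {m b} (v : Vec Bool (suc (suc m))) → oddWeight v ≡ suc b → ∃₂ λ e w → v ≈ₚ e ∷ true ∷ w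
≈ₚ-oddOneToFront (e ∷ true ∷ w) _ = e , w , ε
≈ₚ-oddOneToFront (e ∷ false ∷ v@(_ ∷ _ ∷ _)) eq with ≈ₚ-oddOneToFront v eq
... | e′ , w , v≈ = e , e′ ∷ false ∷ w , ≈ₚ-skip₂ e false v≈ ◅◅ return (swap₁₃ e false e′ true w)

-- The inductive step of ≈ₚ-complete, for vectors whose tails of length m are handled by complete.
module _ {m} (complete : (v w : Vec Bool m) → parityWeights v ≡ parityWeights w → v ≈ₚ w) where

  ≈ₚ-raiseOdd : ∀ e (v w : Vec Bool m) →
    parityWeights (e ∷ false ∷ v) ≡ parityWeights (e ∷ true ∷ w) → e ∷ false ∷ v ≈ₚ e ∷ true ∷ w
  ≈ₚ-raiseOdd e v@(_ ∷ _ ∷ _) w eq with ≈ₚ-oddOneToFront v (,-injectiveʳ eq)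
  ... | e′ , u , v≈ = v≈′ ◅◅ ≈ₚ-skip₂ e true (complete (e′ ∷ false ∷ u) w
                               (parityWeights-cancel₂ e true (e′ ∷ false ∷ u) w (trans (sym (≈ₚ-parityWeights v≈′)) eq)))
    where
    v≈′ : e ∷ false ∷ v ≈ₚ e ∷ true ∷ e′ ∷ false ∷ u
    v≈′ = ≈ₚ-skip₂ e false v≈ ◅◅ return (swap₁₃ e false e′ true u)

  ≈ₚ-sameEvenHead : ∀ e o o′ (v w : Vec Bool m) →
    parityWeights (e ∷ o ∷ v) ≡ parityWeights (e ∷ o′ ∷ w) → e ∷ o ∷ v ≈ₚ e ∷ o′ ∷ w
  ≈ₚ-sameEvenHead e false false v w eq = ≈ₚ-skip₂ e false (complete v w (parityWeights-cancel₂ e false v w eq))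
  ≈ₚ-sameEvenHead e true  true  v w eq = ≈ₚ-skip₂ e true (complete v w (parityWeights-cancel₂ e true v w eq))
  ≈ₚ-sameEvenHead e false true  v w eq = ≈ₚ-raiseOdd e v w eq
  ≈ₚ-sameEvenHead e true  false v w eq = symmetric _ (≈ₚ-raiseOdd e w v (sym eq))

  ≈ₚ-raiseEven : ∀ o o′ (v w : Vec Bool m) →
    parityWeights (false ∷ o ∷ v) ≡ parityWeights (true ∷ o′ ∷ w) → false ∷ o ∷ v ≈ₚ true ∷ o′ ∷ w
  ≈ₚ-raiseEven o o′ v@(_ ∷ _) w eq with ≈ₚ-evenOneToFront v (,-injectiveˡ eq)
  ... | u , v≈ = v≈′ ◅◅ ≈ₚ-sameEvenHead true o o′ (false ∷ u) w (trans (sym (≈ₚ-parityWeights v≈′)) eq)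
    where
    v≈′ : false ∷ o ∷ v ≈ₚ true ∷ o ∷ false ∷ u
    v≈′ = ≈ₚ-skip₂ false o v≈ ◅◅ return (swap₀₂ false o true u)

≈ₚ-complete : ∀ {m} (v w : Vec Bool m) → parityWeights v ≡ parityWeights w → v ≈ₚ w
≈ₚ-complete [] [] _ = ε
≈ₚ-complete (true  ∷ []) (true  ∷ []) _ = ε
≈ₚ-complete (false ∷ []) (false ∷ []) _ = ε
≈ₚ-complete {suc (suc m)} (true  ∷ o ∷ v) (true  ∷ o′ ∷ w) eq =
  ≈ₚ-sameEvenHead (≈ₚ-complete {m}) true o o′ v w eq
≈ₚ-complete {suc (suc m)} (false ∷ o ∷ v) (false ∷ o′ ∷ w) eq =
  ≈ₚ-sameEvenHead (≈ₚ-complete {m}) false o o′ v w eq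
≈ₚ-complete {suc (suc m)} (false ∷ o ∷ v) (true  ∷ o′ ∷ w) eq = ≈ₚ-raiseEven (≈ₚ-complete {m}) o o′ v w eq
≈ₚ-complete {suc (suc m)} (true  ∷ o ∷ v) (false ∷ o′ ∷ w) eq =
  symmetric _ (≈ₚ-raiseEven (≈ₚ-complete {m}) o′ o w v (sym eq))

blockSymmetric-parityWeights : ∀ {m} {f : Vec Bool m → Bool} → IsBlockSymmetric m f →
  ∀ v w → parityWeights v ≡ parityWeights w → f v ≡ f w
blockSymmetric-parityWeights sym-f v w eq = blockSymmetric-≈ₚ sym-f (≈ₚ-complete v w eq)

weight-∷ : ∀ {m} b (v : Vec Bool m) → weight (b ∷ v) ≡ bit b + weight v
weight-∷ true  v = refl
weight-∷ false v = refl

weight≡∑ : ∀ {m} (v : Vec Bool m) → weight v ≡ ∑[ i < m ] bit (lookup v i)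
weight≡∑ []      = refl
weight≡∑ (b ∷ v) = trans (weight-∷ b v) (cong (bit b +_) (weight≡∑ v))

weight-tabulate : ∀ {m} (g : Fin m → Bool) → weight (tabulate g) ≡ ∑[ i < m ] bit (g i)
weight-tabulate g = trans (weight≡∑ (tabulate g)) (sum-cong-≗ (λ i → cong bit (lookup∘tabulate g i)))

∑-const : ∀ m c → ∑[ i < m ] c ≡ m * c
∑-const zero    c = refl
∑-const (suc m) c = cong (c +_) (∑-const m c)

∑-<ᵇ : ∀ {m r} → r ≤ m → ∑[ j < m ] bit (toℕ j <ᵇ r) ≡ r
∑-<ᵇ {zero}  z≤n     = refl
∑-<ᵇ {suc m} {zero}  _         = trans (∑-const (suc m) 0) (*-zeroʳ m)
∑-<ᵇ {suc m} {suc r} (s≤s r≤m) = cong suc (∑-<ᵇ r≤m)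

∑-∸ : ∀ {m} (f g : Fin m → ℕ) → (∀ i → g i ≤ f i) →
  ∑[ i < m ] (f i ∸ g i) + ∑[ i < m ] g i ≡ ∑[ i < m ] f i
∑-∸ f g g≤f = trans (sym (∑-distrib-+ (λ i → f i ∸ g i) g)) (sum-cong-≗ (λ i → m∸n+n≡m (g≤f i)))

twoLevel : ∀ {m} → ℕ → ℕ → ℕ → Fin m → ℕ
twoLevel c a b i = if toℕ i <ᵇ c then a else b

twoLevel-elim : ∀ {m} c (P : ℕ → Set) {a b} → P a → P b → (i : Fin m) → P (twoLevel c a b i)
twoLevel-elim c P pa pb i with toℕ i <ᵇ c
... | true  = pa
... | false = pb

∑-twoLevel : ∀ c m a b → ∑[ i < c + m ] twoLevel c a b i ≡ c * a + m * b
∑-twoLevel zero    m a b = ∑-const m b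
∑-twoLevel (suc c) m a b = trans (cong (a +_) (∑-twoLevel c m a b)) (sym (+-assoc a (c * a) (m * b)))

row : ∀ {A : Set} {k m} → Fin k → Vec (Vec A k) m → Vec A m
row i = map (λ c → lookup c i)

columnsOf : ∀ {A : Set} {k p} → Vec (Vec A p) k → Vec (Vec A k) p
columnsOf rows = tabulate (λ j → row j rows)

row-columnsOf : ∀ {A : Set} {k p} (rows : Vec (Vec A p) k) i → row i (columnsOf rows) ≡ lookup rows i
row-columnsOf rows i = begin
  row i (tabulate (λ j → row j rows))              ≡⟨ tabulate-∘ _ _ ⟨
  tabulate (λ j → lookup (row j rows) i)           ≡⟨ tabulate-cong (λ j → lookup-map i _ rows) ⟩
  tabulate (λ j → lookup (lookup rows i) j)        ≡⟨ tabulate∘lookup (lookup rows i) ⟩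
  lookup rows i                                    ∎
  where open ≡-Reasoning

-- interleave′ lands in length suc (n * 2), which unfolds along the recursion;
-- interleave transports it to the arity suc (2 * n) used by Is2BlockSymmetric.
interleave′ : ∀ {A : Set} {n} → Vec A (suc n) → Vec A n → Vec A (suc (n * 2))
interleave′ {n = zero}  (e ∷ []) []       = e ∷ []
interleave′ {n = suc n} (e ∷ es) (o ∷ os) = e ∷ o ∷ interleave′ es os

interleave : ∀ {A : Set} {n} → Vec A (suc n) → Vec A n → Vec A (suc (2 * n))
interleave {A} {n} es os = subst (Vec A) (cong suc (*-comm n 2)) (interleave′ es os)

map-interleave : ∀ {A B : Set} {n} (g : A → B) (es : Vec A (suc n)) (os : Vec A n) →
  map g (interleave es os) ≡ interleave (map g es) (map g os)
map-interleave {A} {B} {n} g es os =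
  trans (sym (subst-application′ (Vec A) (λ _ → map g) (cong suc (*-comm n 2))))
        (cong (subst (Vec B) (cong suc (*-comm n 2))) (map-interleave′ es os))
  where
  map-interleave′ : ∀ {n} (es : Vec A (suc n)) (os : Vec A n) →
    map g (interleave′ es os) ≡ interleave′ (map g es) (map g os)
  map-interleave′ {zero}  (e ∷ []) []       = refl
  map-interleave′ {suc n} (e ∷ es) (o ∷ os) = cong (λ v → g e ∷ g o ∷ v) (map-interleave′ es os)

All-interleave : ∀ {A : Set} {P : A → Set} {n} {es : Vec A (suc n)} {os : Vec A n} →
  All P es → All P os → All P (interleave es os)
All-interleave {P = P} {n} pes pos = All-subst (cong suc (*-comm n 2)) (All-interleave′ pes pos)
  where
  All-subst : ∀ {m m′} (eq : m ≡ m′) {v} → All P v → All P (subst (Vec _) eq v)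
  All-subst refl pv = pv
  All-interleave′ : ∀ {n} {es : Vec _ (suc n)} {os : Vec _ n} → All P es → All P os → All P (interleave′ es os)
  All-interleave′ {zero}  (pe ∷ []) []         = pe ∷ []
  All-interleave′ {suc n} (pe ∷ pes) (po ∷ pos) = pe ∷ po ∷ All-interleave′ pes pos

parityWeights-interleave : ∀ {n} (es : Vec Bool (suc n)) (os : Vec Bool n) →
  parityWeights (interleave es os) ≡ (weight es , weight os)
parityWeights-interleave {n} es os = trans (parityWeights-subst (cong suc (*-comm n 2))) (parityWeights-interleave′ es os)
  where
  parityWeights-subst : ∀ {m m′} (eq : m ≡ m′) {v} → parityWeights (subst (Vec Bool) eq v) ≡ parityWeights v
  parityWeights-subst refl = refl
  parityWeights-interleave′ : ∀ {n} (es : Vec Bool (suc n)) (os : Vec Bool n) →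
    parityWeights (interleave′ es os) ≡ (weight es , weight os)
  parityWeights-interleave′ {zero}  (e ∷ []) []       = cong (_, 0) (sym (weight-∷ e []))
  parityWeights-interleave′ {suc n} (e ∷ es) (o ∷ os) with parityWeights-interleave′ es os
  ... | eq = cong₂ _,_ (trans (cong (bit e +_) (,-injectiveˡ eq)) (sym (weight-∷ e es)))
                       (trans (cong (bit o +_) (,-injectiveʳ eq)) (sym (weight-∷ o os)))

-- Prescribed row weights and columns of weight t

bit-∧-split : ∀ {x y} → x ≤𝔹 y → bit x + bit (not x ∧ y) ≡ bit y
bit-∧-split {false} b≤b = refl
bit-∧-split {true}  b≤b = refl
bit-∧-split         f≤t = refl

bit-∨-split : ∀ {x y} → y ≤𝔹 x → bit x + bit (not x ∨ y) ≡ suc (bit y)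
bit-∨-split {false} b≤b = refl
bit-∨-split {true}  b≤b = refl
bit-∨-split         f≤t = refl

<ᵇ-monoʳ : ∀ j {m n} → m ≤ n → (j <ᵇ m) ≤𝔹 (j <ᵇ n)
<ᵇ-monoʳ j       z≤n       = ≤-minimum _
<ᵇ-monoʳ zero    (s≤s _)   = b≤b
<ᵇ-monoʳ (suc j) (s≤s m≤n) = <ᵇ-monoʳ j m≤n

quotient-unique : ∀ {p q r t} .{{_ : NonZero p}} → q * p + r ≡ t * p → r < p → q ≡ t × r ≡ 0
quotient-unique {p} {q} {r} {t} eq r<p =
  *-cancelʳ-≡ q t p (trans (sym (+-identityʳ (q * p))) (subst (λ z → q * p + z ≡ t * p) r≡0 eq)) , r≡0
  where
  open ≡-Reasoning
  r≡0 : r ≡ 0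
  r≡0 = begin
    r               ≡⟨ m<n⇒m%n≡m r<p ⟨
    r % p           ≡⟨ [m+kn]%n≡m%n r q p ⟨
    (r + q * p) % p ≡⟨ cong (_% p) (trans (+-comm r (q * p)) eq) ⟩
    (t * p) % p     ≡⟨ m*n%n≡0 t p ⟩
    0               ∎

-- Row i covers the ρ i cyclically consecutive positions of ℤ/p that follow
-- those of row i − 1, the first row starting at r; carry records a wrap-around.
-- When ∑ ρ = t · p the rows go round exactly t times, so every column is covered
-- t times.
module WrapAround (p : ℕ) .{{_ : NonZero p}} where

  carry : ℕ → ℕ → ℕ
  carry r ρ = if r + ρ <ᵇ p then 0 else 1

  next : ℕ → ℕ → ℕ
  next r ρ = if r + ρ <ᵇ p then r + ρ else r + ρ ∸ p

  covers : ℕ → ℕ → ℕ → Bool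
  covers r ρ j = if r + ρ <ᵇ p then not (j <ᵇ r) ∧ (j <ᵇ r + ρ) else not (j <ᵇ r) ∨ (j <ᵇ r + ρ ∸ p)

  arc : ℕ → ℕ → Vec Bool p
  arc r ρ = tabulate (λ j → covers r ρ (toℕ j))

  covers-step : ∀ r {ρ} → ρ ≤ p → ∀ j → bit (j <ᵇ r) + bit (covers r ρ j) ≡ carry r ρ + bit (j <ᵇ next r ρ)
  covers-step r {ρ} ρ≤p j with r + ρ <ᵇ p
  ... | true  = bit-∧-split (<ᵇ-monoʳ j (m≤m+n r ρ))
  ... | false = bit-∨-split (<ᵇ-monoʳ j (≤-trans (∸-monoʳ-≤ (r + ρ) ρ≤p) (≤-reflexive (m+n∸n≡m r ρ))))

  carry*p+next : ∀ r ρ → carry r ρ * p + next r ρ ≡ r + ρ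
  carry*p+next r ρ with r + ρ <ᵇ p in eq
  ... | true  = refl
  ... | false = trans (cong (_+ (r + ρ ∸ p)) (+-identityʳ p)) (m+[n∸m]≡n p≤r+ρ)
    where
    p≤r+ρ : p ≤ r + ρ
    p≤r+ρ = ≮⇒≥ (λ r+ρ<p → subst T eq (<⇒<ᵇ r+ρ<p))

  next<p : ∀ {r ρ} → r < p → ρ ≤ p → next r ρ < p
  next<p {r} {ρ} r<p ρ≤p with r + ρ <ᵇ p in eq
  ... | true  = <ᵇ⇒< (r + ρ) p (subst T (sym eq) tt)
  ... | false = m<n+o⇒m∸n<o (r + ρ) p (+-mono-<-≤ r<p ρ≤p)

  weight-arc : ∀ {r ρ} → r < p → ρ ≤ p → weight (arc r ρ) ≡ ρ
  weight-arc {r} {ρ} r<p ρ≤p = +-cancelˡ-≡ r _ _ (begin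
    r + weight (arc r ρ)
      ≡⟨ cong₂ _+_ (sym (∑-<ᵇ {p} {r} (<⇒≤ r<p))) (weight-tabulate {p} (λ j → covers r ρ (toℕ j))) ⟩
    ∑[ j < p ] bit (toℕ j <ᵇ r) + ∑[ j < p ] bit (covers r ρ (toℕ j))
      ≡⟨ ∑-distrib-+ {p} (λ j → bit (toℕ j <ᵇ r)) (λ j → bit (covers r ρ (toℕ j))) ⟨
    ∑[ j < p ] (bit (toℕ j <ᵇ r) + bit (covers r ρ (toℕ j)))
      ≡⟨ sum-cong-≗ {p} (covers-step r ρ≤p ∘ toℕ) ⟩
    ∑[ j < p ] (carry r ρ + bit (toℕ j <ᵇ next r ρ))
      ≡⟨ ∑-distrib-+ {p} (λ _ → carry r ρ) (λ j → bit (toℕ j <ᵇ next r ρ)) ⟩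
    ∑[ j < p ] carry r ρ + ∑[ j < p ] bit (toℕ j <ᵇ next r ρ)
      ≡⟨ cong₂ _+_ (trans (∑-const p (carry r ρ)) (*-comm p (carry r ρ))) (∑-<ᵇ {p} (<⇒≤ (next<p r<p ρ≤p))) ⟩
    carry r ρ * p + next r ρ
      ≡⟨ carry*p+next r ρ ⟩
    r + ρ ∎)
    where open ≡-Reasoning

  arcs : ∀ {k} → ℕ → (Fin k → ℕ) → Vec (Vec Bool p) k
  arcs {zero}  r ρ = []
  arcs {suc k} r ρ = arc r (ρ zero) ∷ arcs (next r (ρ zero)) (ρ ∘ suc)

  turns : ∀ {k} → ℕ → (Fin k → ℕ) → ℕ
  turns {zero}  r ρ = 0
  turns {suc k} r ρ = carry r (ρ zero) + turns (next r (ρ zero)) (ρ ∘ suc)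

  end : ∀ {k} → ℕ → (Fin k → ℕ) → ℕ
  end {zero}  r ρ = r
  end {suc k} r ρ = end (next r (ρ zero)) (ρ ∘ suc)

  turns*p+end : ∀ {k} r (ρ : Fin k → ℕ) → turns r ρ * p + end r ρ ≡ r + ∑[ i < k ] ρ i
  turns*p+end {zero}  r ρ = sym (+-identityʳ r)
  turns*p+end {suc k} r ρ = begin
    (c + turns r′ (ρ ∘ suc)) * p + end r′ (ρ ∘ suc)    ≡⟨ cong (_+ end r′ (ρ ∘ suc)) (*-distribʳ-+ p c _) ⟩
    c * p + turns r′ (ρ ∘ suc) * p + end r′ (ρ ∘ suc)  ≡⟨ +-assoc (c * p) _ _ ⟩
    c * p + (turns r′ (ρ ∘ suc) * p + end r′ (ρ ∘ suc)) ≡⟨ cong (c * p +_) (turns*p+end r′ (ρ ∘ suc)) ⟩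
    c * p + (r′ + ∑[ i < k ] ρ (suc i))                ≡⟨ +-assoc (c * p) r′ _ ⟨
    c * p + r′ + ∑[ i < k ] ρ (suc i)                  ≡⟨ cong (_+ ∑[ i < k ] ρ (suc i)) (carry*p+next r (ρ zero)) ⟩
    r + ρ zero + ∑[ i < k ] ρ (suc i)                  ≡⟨ +-assoc r (ρ zero) _ ⟩
    r + ∑[ i < suc k ] ρ i                             ∎
    where
    open ≡-Reasoning
    c r′ : ℕ
    c  = carry r (ρ zero)
    r′ = next r (ρ zero)

  end<p : ∀ {k r} (ρ : Fin k → ℕ) → r < p → (∀ i → ρ i ≤ p) → end r ρ < p
  end<p {zero}  ρ r<p ρ≤p = r<p
  end<p {suc k} ρ r<p ρ≤p = end<p (ρ ∘ suc) (next<p r<p (ρ≤p zero)) (ρ≤p ∘ suc)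

  weight-arcs : ∀ {k r} (ρ : Fin k → ℕ) → r < p → (∀ i → ρ i ≤ p) →
    ∀ i → weight (lookup (arcs r ρ) i) ≡ ρ i
  weight-arcs ρ r<p ρ≤p zero    = weight-arc r<p (ρ≤p zero)
  weight-arcs ρ r<p ρ≤p (suc i) = weight-arcs (ρ ∘ suc) (next<p r<p (ρ≤p zero)) (ρ≤p ∘ suc) i

  weight-column : ∀ {k} r (ρ : Fin k → ℕ) → (∀ i → ρ i ≤ p) → ∀ j →
    bit (toℕ j <ᵇ r) + weight (row j (arcs r ρ)) ≡ turns r ρ + bit (toℕ j <ᵇ end r ρ)
  weight-column {zero}  r ρ ρ≤p j = +-identityʳ _
  weight-column {suc k} r ρ ρ≤p j = begin
    bit (toℕ j <ᵇ r) + weight (lookup (arc r (ρ zero)) j ∷ rest)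
      ≡⟨ cong (λ b → bit (toℕ j <ᵇ r) + weight (b ∷ rest)) (lookup∘tabulate _ j) ⟩
    bit (toℕ j <ᵇ r) + weight (covers r (ρ zero) (toℕ j) ∷ rest)
      ≡⟨ cong (bit (toℕ j <ᵇ r) +_) (weight-∷ (covers r (ρ zero) (toℕ j)) rest) ⟩
    bit (toℕ j <ᵇ r) + (bit (covers r (ρ zero) (toℕ j)) + weight rest)
      ≡⟨ +-assoc (bit (toℕ j <ᵇ r)) _ _ ⟨
    bit (toℕ j <ᵇ r) + bit (covers r (ρ zero) (toℕ j)) + weight rest
      ≡⟨ cong (_+ weight rest) (covers-step r (ρ≤p zero) (toℕ j)) ⟩
    carry r (ρ zero) + bit (toℕ j <ᵇ next r (ρ zero)) + weight rest
      ≡⟨ +-assoc (carry r (ρ zero)) _ _ ⟩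
    carry r (ρ zero) + (bit (toℕ j <ᵇ next r (ρ zero)) + weight rest)
      ≡⟨ cong (carry r (ρ zero) +_) (weight-column (next r (ρ zero)) (ρ ∘ suc) (ρ≤p ∘ suc) j) ⟩
    carry r (ρ zero) + (turns (next r (ρ zero)) (ρ ∘ suc) + bit (toℕ j <ᵇ end r ρ))
      ≡⟨ +-assoc (carry r (ρ zero)) _ _ ⟨
    turns r ρ + bit (toℕ j <ᵇ end r ρ) ∎
    where
    open ≡-Reasoning
    rest : Vec Bool k
    rest = row j (arcs (next r (ρ zero)) (ρ ∘ suc))

realiseRowWeights : ∀ {k} p t (ρ : Fin k → ℕ) → 0 < p → (∀ i → ρ i ≤ p) → ∑[ i < k ] ρ i ≡ t * p →
  Σ (Vec (Tuple k) p) λ cols → All (λ c → weight c ≡ t) cols × (∀ i → weight (row i cols) ≡ ρ i)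
realiseRowWeights p t ρ 0<p ρ≤p ∑ρ≡t*p = columnsOf (arcs 0 ρ) , lookup⁻ weight-column-t , weight-row
  where
  instance
    p≢0 : NonZero p
    p≢0 = >-nonZero 0<p
  open WrapAround p
  turns≡t×end≡0 : turns 0 ρ ≡ t × end 0 ρ ≡ 0
  turns≡t×end≡0 = quotient-unique (trans (turns*p+end 0 ρ) ∑ρ≡t*p) (end<p ρ 0<p ρ≤p)
  weight-column-t : ∀ j → weight (lookup (columnsOf (arcs 0 ρ)) j) ≡ t
  weight-column-t j with turns≡t×end≡0
  ... | turns≡t , end≡0 = begin
    weight (lookup (columnsOf (arcs 0 ρ)) j)   ≡⟨ cong weight (lookup∘tabulate _ j) ⟩
    weight (row j (arcs 0 ρ))                  ≡⟨ weight-column 0 ρ ρ≤p j ⟩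
    turns 0 ρ + bit (toℕ j <ᵇ end 0 ρ)         ≡⟨ cong₂ (λ q e → q + bit (toℕ j <ᵇ e)) turns≡t end≡0 ⟩
    t + 0                                      ≡⟨ +-identityʳ t ⟩
    t                                          ∎
    where open ≡-Reasoning
  weight-row : ∀ i → weight (row i (columnsOf (arcs 0 ρ))) ≡ ρ i
  weight-row i = trans (cong weight (row-columnsOf (arcs 0 ρ) i)) (weight-arcs ρ 0<p ρ≤p i)

weight-++ : ∀ {m m′} (v : Vec Bool m) (w : Vec Bool m′) → weight (v ++ w) ≡ weight v + weight w
weight-++ []      w = refl
weight-++ (b ∷ v) w = begin
  weight (b ∷ v ++ w)         ≡⟨ weight-∷ b (v ++ w) ⟩
  bit b + weight (v ++ w)     ≡⟨ cong (bit b +_) (weight-++ v w) ⟩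
  bit b + (weight v + weight w) ≡⟨ +-assoc (bit b) _ _ ⟨
  bit b + weight v + weight w ≡⟨ cong (_+ weight w) (weight-∷ b v) ⟨
  weight (b ∷ v) + weight w   ∎
  where open ≡-Reasoning

weight-replicate : ∀ s b → weight (replicate s b) ≡ s * bit b
weight-replicate zero    b = refl
weight-replicate (suc s) b = trans (weight-∷ b (replicate s b)) (cong (bit b +_) (weight-replicate s b))

Matrix : ∀ {k} → Rel k → (m : ℕ) → (Vec Bool m → Set) → Set
Matrix {k} R m P = Σ (Vec (Tuple k) m) λ cols → All R cols × (∀ i → P (row i cols))

*-bit≤ : ∀ s b → s * bit b ≤ s
*-bit≤ s true  = ≤-reflexive (*-identityʳ s)
*-bit≤ s false = subst (_≤ s) (sym (*-zeroʳ s)) z≤n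

∑-∸-copies : ∀ {k} t (x : Tuple k) s p (v : Fin k → ℕ) → (∀ i → s ≤ v i) →
  ∑[ i < k ] v i ≡ t * p + s * weight x →
  ∑[ i < k ] (v i ∸ s * bit (lookup x i)) ≡ t * p
∑-∸-copies {k} t x s p v s≤v ∑v = +-cancelʳ-≡ (s * weight x) _ _ (begin
  ∑[ i < k ] (v i ∸ copies i) + s * weight x       ≡⟨ cong (∑[ i < k ] (v i ∸ copies i) +_) ∑copies ⟨
  ∑[ i < k ] (v i ∸ copies i) + ∑[ i < k ] copies i ≡⟨ ∑-∸ v copies (λ i → ≤-trans (*-bit≤ s (lookup x i)) (s≤v i)) ⟩
  ∑[ i < k ] v i                                    ≡⟨ ∑v ⟩
  t * p + s * weight x                              ∎)
  where
  open ≡-Reasoning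
  copies : Fin k → ℕ
  copies i = s * bit (lookup x i)
  ∑copies : ∑[ i < k ] copies i ≡ s * weight x
  ∑copies = sym (trans (cong (s *_) (weight≡∑ x)) (*-distribˡ-sum s (λ i → bit (lookup x i))))

weight-row-replicate-++ : ∀ {k p} s (x : Tuple k) (T : Vec (Tuple k) p) i →
  weight (row i (replicate s x ++ T)) ≡ s * bit (lookup x i) + weight (row i T)
weight-row-replicate-++ s x T i = begin
  weight (row i (replicate s x ++ T))                ≡⟨ cong weight (map-++ _ (replicate s x) T) ⟩
  weight (row i (replicate s x) ++ row i T)          ≡⟨ weight-++ (row i (replicate s x)) (row i T) ⟩
  weight (row i (replicate s x)) + weight (row i T)  ≡⟨ cong (_+ weight (row i T)) (cong weight (map-replicate _ x s)) ⟩
  weight (replicate s (lookup x i)) + weight (row i T) ≡⟨ cong (_+ weight (row i T)) (weight-replicate s (lookup x i)) ⟩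
  s * bit (lookup x i) + weight (row i T)            ∎
  where open ≡-Reasoning

copiesAndRealisation : ∀ {k} t (x : Tuple k) s p (v : Fin k → ℕ) → 0 < p →
  (∀ i → s ≤ v i) → (∀ i → v i ≤ p) → ∑[ i < k ] v i ≡ t * p + s * weight x →
  Σ (Vec (Tuple k) (s + p)) λ cols → All (I∪ k t x) cols × (∀ i → weight (row i cols) ≡ v i)
copiesAndRealisation t x s p v 0<p s≤v v≤p ∑v
  with realiseRowWeights p t (λ i → v i ∸ s * bit (lookup x i)) 0<p
         (λ i → ≤-trans (m∸n≤m (v i) (s * bit (lookup x i))) (v≤p i)) (∑-∸-copies t x s p v s≤v ∑v)
... | T , T-weights , T-rows =
  replicate s x ++ T ,
  ++⁺ (lookup⁻ (λ i → inj₂ (lookup-replicate i x))) (All.map inj₁ T-weights) ,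
  λ i → trans (weight-row-replicate-++ s x T i)
              (trans (cong (s * bit (lookup x i) +_) (T-rows i)) (m+[n∸m]≡n (≤-trans (*-bit≤ s (lookup x i)) (s≤v i))))

interleave-Matrix : ∀ {k n} {R : Rel k} {a b c} →
  Matrix R (suc n) (λ r → weight r ≡ a ⊎ weight r ≡ b) → Matrix R n (λ r → weight r ≡ c) →
  Matrix R (suc (2 * n)) (λ r → parityWeights r ≡ (a , c) ⊎ parityWeights r ≡ (b , c))
interleave-Matrix (E , E∈R , E-rows) (O , O∈R , O-rows) = interleave E O , All-interleave E∈R O∈R , rows
  where
  rows : ∀ i → parityWeights (row i (interleave E O)) ≡ (_ , _) ⊎ parityWeights (row i (interleave E O)) ≡ (_ , _)
  rows i with trans (cong parityWeights (map-interleave _ E O)) (parityWeights-interleave (row i E) (row i O)) | E-rows i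
  ... | eq | inj₁ wa = inj₁ (trans eq (cong₂ _,_ wa (O-rows i)))
  ... | eq | inj₂ wb = inj₂ (trans eq (cong₂ _,_ wb (O-rows i)))

-- Separation by NAE

≡-replicate : ∀ {A : Set} {k} (y : Vec A k) c → (∀ i → lookup y i ≡ c) → y ≡ replicate k c
≡-replicate []      c _   = refl
≡-replicate (b ∷ y) c all = cong₂ _∷_ (all zero) (≡-replicate y c (λ i → all (suc i)))

NAE-nonconstant : ∀ {k} {y : Tuple k} c → NAE k y → ¬ (∀ i → lookup y i ≡ c)
NAE-nonconstant true  (_ , ≢ones)  all = ≢ones  (≡-replicate _ true all)
NAE-nonconstant false (≢zeros , _) all = ≢zeros (≡-replicate _ false all)

nae-separates : ∀ {k m} {R : Rel k} {f : Vec Bool m → Bool} {a b} →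
  IsPolymorphism R (NAE k) m f → IsBlockSymmetric m f →
  Matrix R m (λ r → parityWeights r ≡ a ⊎ parityWeights r ≡ b) →
  ∀ v w → parityWeights v ≡ a → parityWeights w ≡ b → f v ≢ f w
nae-separates {f = f} poly sym-f (cols , cols∈R , rows) v w v∈a w∈b fv≡fw =
  NAE-nonconstant (f v) (poly cols cols∈R) output≡fv
  where
  output≡fv : ∀ i → lookup (applyRows f cols) i ≡ f v
  output≡fv i with rows i
  ... | inj₁ r∈a = trans (lookup∘tabulate _ i) (blockSymmetric-parityWeights sym-f _ v (trans r∈a (sym v∈a)))
  ... | inj₂ r∈b = trans (lookup∘tabulate _ i)
                         (trans (blockSymmetric-parityWeights sym-f _ w (trans r∈b (sym w∈b))) (sym fv≡fw))

prefix : ∀ m → ℕ → Vec Bool m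
prefix m r = tabulate (λ j → toℕ j <ᵇ r)

weight-prefix : ∀ {m r} → r ≤ m → weight (prefix m r) ≡ r
weight-prefix {m} {r} r≤m = trans (weight-tabulate {m} (λ j → toℕ j <ᵇ r)) (∑-<ᵇ {m} r≤m)

withParityWeights : ∀ n a b → Vec Bool (suc (2 * n))
withParityWeights n a b = interleave (prefix (suc n) a) (prefix n b)

parityWeights-withParityWeights : ∀ {n a b} → a ≤ suc n → b ≤ n → parityWeights (withParityWeights n a b) ≡ (a , b)
parityWeights-withParityWeights {n} {a} {b} a≤1+n b≤n =
  trans (parityWeights-interleave (prefix (suc n) a) (prefix n b)) (cong₂ _,_ (weight-prefix a≤1+n) (weight-prefix b≤n))

no-three-distinct : (a b c : Bool) → a ≢ b → b ≢ c → a ≢ c → ⊥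
no-three-distinct true  true  _     a≢b _   _   = a≢b refl
no-three-distinct false false _     a≢b _   _   = a≢b refl
no-three-distinct true  false true  _   _   a≢c = a≢c refl
no-three-distinct true  false false _   b≢c _   = b≢c refl
no-three-distinct false true  true  _   b≢c _   = b≢c refl
no-three-distinct false true  false _   _   a≢c = a≢c refl

odd⇒≡1+2* : ∀ k → ¬ (2 ∣ k) → ∃ λ h → k ≡ suc (2 * h)
odd⇒≡1+2* zero          ¬2∣k = ⊥-elim (¬2∣k (2 ∣0))
odd⇒≡1+2* (suc zero)    _    = 0 , refl
odd⇒≡1+2* (suc (suc k)) ¬2∣k with odd⇒≡1+2* k (λ 2∣k → ¬2∣k (∣m∣n⇒∣m+n ∣-refl 2∣k))
... | h , refl = suc h , cong (λ m → suc (suc m)) (sym (+-suc h (h + 0)))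

twoLevelMatrix : ∀ {k} t (x : Tuple k) s p c a b → 0 < p → s ≤ a → s ≤ b → a ≤ p → b ≤ p →
  ∑[ i < k ] twoLevel c a b i ≡ t * p + s * weight x →
  Matrix (I∪ k t x) (s + p) (λ r → weight r ≡ a ⊎ weight r ≡ b)
twoLevelMatrix t x s p c a b 0<p s≤a s≤b a≤p b≤p ∑≡
  with copiesAndRealisation t x s p (twoLevel c a b) 0<p
         (twoLevel-elim c (s ≤_) s≤a s≤b)
         (twoLevel-elim c (_≤ p) a≤p b≤p) ∑≡
... | cols , cols∈I , rows =
  cols , cols∈I ,
  λ i → subst (λ z → z ≡ a ⊎ z ≡ b) (sym (rows i)) (twoLevel-elim c (λ z → z ≡ a ⊎ z ≡ b) (inj₁ refl) (inj₂ refl) i)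

-- The odd block has n = k(t + 1) columns and row weights u = t(t + 1), since
-- k · u = t · n.  The even blocks have n + 1 columns, so their row weights add
-- up to t(n + 1) = k · u + t: one row u + t and k − 1 rows u (α); h + 1 rows
-- u + t and h rows u − t = t² when k = 2h + 1 (γ); t copies of x, contributing
-- t · d, and g rows t² and k − g rows u, where t = d + g + 1 (β).
module Construction {k t : ℕ} (x : Tuple k) (0<t : 0 < t) (t<k : t < k) where

  n u vP vM : ℕ
  n  = k * suc t
  u  = t * suc t
  vP = u + t
  vM = t * t

  u≤n : u ≤ n
  u≤n = *-monoˡ-≤ (suc t) (<⇒≤ t<k)

  vP<n : vP < n
  vP<n = subst (_≤ n) (sym (square t)) (*-monoˡ-≤ (suc t) t<k)
    where
    square : ∀ t → suc (t * suc t + t) ≡ suc t * suc t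
    square = solve-∀

  vP≤1+n : vP ≤ suc n
  vP≤1+n = ≤-trans (<⇒≤ vP<n) (n≤1+n n)

  u≤vP : u ≤ vP
  u≤vP = m≤m+n u t

  vM≤u : vM ≤ u
  vM≤u = *-monoʳ-≤ t (n≤1+n t)

  u≤1+n : u ≤ suc n
  u≤1+n = ≤-trans u≤vP vP≤1+n

  vM≤1+n : vM ≤ suc n
  vM≤1+n = ≤-trans vM≤u u≤1+n

  0<u : 0 < u
  0<u = ≤-trans (s≤s z≤n) (*-monoˡ-≤ (suc t) 0<t)

  oddMatrix : Matrix (I∪ k t x) n (λ r → weight r ≡ u)
  oddMatrix = copiesAndRealisation t x 0 n (λ _ → u) (≤-trans 0<u u≤n) (λ _ → z≤n) (λ _ → u≤n)
    (trans (∑-const k u) (identity k t))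
    where
    identity : ∀ k t → k * (t * suc t) ≡ t * (k * suc t) + 0
    identity = solve-∀

  αMatrix : ∀ {k₁} → k ≡ suc k₁ → Matrix (I∪ k t x) (suc n) (λ r → weight r ≡ vP ⊎ weight r ≡ u)
  αMatrix {k₁} refl = twoLevelMatrix t x 0 (suc n) 1 vP u (s≤s z≤n) z≤n z≤n vP≤1+n u≤1+n
    (trans (∑-twoLevel 1 k₁ vP u) (identity k₁ t))
    where
    identity : ∀ k₁ t → 1 * (t * suc t + t) + k₁ * (t * suc t) ≡ t * suc (suc k₁ * suc t) + 0
    identity = solve-∀

  γMatrix : ∀ {h} → k ≡ suc (2 * h) → Matrix (I∪ k t x) (suc n) (λ r → weight r ≡ vP ⊎ weight r ≡ vM)
  γMatrix {h} refl = twoLevelMatrix t x 0 (suc n) (suc h) vP vM (s≤s z≤n) z≤n z≤n vP≤1+n vM≤1+n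
    (trans (cong (λ m → ∑[ i < suc (h + m) ] twoLevel (suc h) vP vM i) (+-identityʳ h))
           (trans (∑-twoLevel (suc h) h vP vM) (identity h t)))
    where
    identity : ∀ h t → suc h * (t * suc t + t) + h * (t * t) ≡ t * suc (suc (2 * h) * suc t) + 0
    identity = solve-∀

  βMatrix : ∀ {d g} → weight x ≡ d → t ≡ suc (d + g) →
    Matrix (I∪ k t x) (suc n) (λ r → weight r ≡ vM ⊎ weight r ≡ u)
  βMatrix {d} {g} wx≡d t≡1+d+g =
    subst (λ m → Matrix (I∪ k t x) m (λ r → weight r ≡ vM ⊎ weight r ≡ u)) t+p≡1+n
    (twoLevelMatrix t x t p g vM u (≤-trans 0<u u≤p) t≤vM (≤-trans t≤vM vM≤u) (≤-trans vM≤u u≤p) u≤p ∑≡)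
    where
    open ≡-Reasoning
    p : ℕ
    p = suc n ∸ t
    t+p≡1+n : t + p ≡ suc n
    t+p≡1+n = m+[n∸m]≡n (≤-trans (m≤n+m t u) vP≤1+n)
    u≤p : u ≤ p
    u≤p = m+n≤o⇒m≤o∸n u vP≤1+n
    t≤vM : t ≤ vM
    t≤vM = subst (_≤ vM) (*-identityʳ t) (*-monoʳ-≤ t 0<t)
    g<t : g < t
    g<t = subst (g <_) (sym t≡1+d+g) (s≤s (m≤n+m g d))
    K : ℕ
    K = k ∸ g
    k≡g+K : k ≡ g + K
    k≡g+K = sym (m+[n∸m]≡n (<⇒≤ (<-trans g<t t<k)))
    d+g+p≡n : d + g + p ≡ n
    d+g+p≡n = suc-injective (trans (cong (_+ p) (sym t≡1+d+g)) t+p≡1+n)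
    ∑≡ : ∑[ i < k ] twoLevel g vM u i ≡ t * p + t * weight x
    ∑≡ = +-cancelʳ-≡ (t * g) _ _ (begin
      ∑[ i < k ] twoLevel g vM u i + t * g    ≡⟨ cong (λ m → ∑[ i < m ] twoLevel g vM u i + t * g) k≡g+K ⟩
      ∑[ i < g + K ] twoLevel g vM u i + t * g ≡⟨ cong (_+ t * g) (∑-twoLevel g K vM u) ⟩
      g * vM + K * u + t * g                  ≡⟨ split g K t ⟨
      t * ((g + K) * suc t)                   ≡⟨ cong (λ m → t * (m * suc t)) k≡g+K ⟨
      t * n                                   ≡⟨ cong (t *_) d+g+p≡n ⟨
      t * (d + g + p)                         ≡⟨ distribute t d g p ⟩
      t * p + t * d + t * g                   ≡⟨ cong (λ w → t * p + t * w + t * g) wx≡d ⟨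
      t * p + t * weight x + t * g            ∎)
      where
      split : ∀ g K t → t * ((g + K) * suc t) ≡ g * (t * t) + K * (t * suc t) + t * g
      split = solve-∀
      distribute : ∀ t d g p → t * (d + g + p) ≡ t * p + t * d + t * g
      distribute = solve-∀

  at : ℕ → Vec Bool (suc (2 * n))
  at a = withParityWeights n a u

  separates : ∀ {f} → IsPolymorphism (I∪ k t x) (NAE k) (suc (2 * n)) f → IsBlockSymmetric (suc (2 * n)) f →
    ∀ {a b} → a ≤ suc n → b ≤ suc n → Matrix (I∪ k t x) (suc n) (λ r → weight r ≡ a ⊎ weight r ≡ b) →
    f (at a) ≢ f (at b)
  separates poly sym-f a≤1+n b≤1+n E = nae-separates poly sym-f (interleave-Matrix E oddMatrix) _ _
    (parityWeights-withParityWeights a≤1+n u≤n) (parityWeights-withParityWeights b≤1+n u≤n)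

proposition4p7 : (k t d : ℕ) → 3 ≤ k → 1 < t → t < k → 1 ≤ d → d < t → t + d ≤ k →
    ¬ (2 ∣ k) → 2 ∣ t → 2 ∣ d →
    (x : Vec Bool k) → weight x ≡ d →
    Σ ℕ (λ n → ¬ (Σ (Vec Bool (suc (2 * n)) → Bool) (λ f →
      IsPolymorphism (I∪ k t x) (NAE k) (suc (2 * n)) f × Is2BlockSymmetric n f)))
proposition4p7 k t d _ _ t<k _ d<t _ ¬2∣k _ _ x wx≡d
  with odd⇒≡1+2* k ¬2∣k | m≤n⇒∃[o]m+o≡n d<t
... | h , k≡1+2h | g , 1+d+g≡t = n , λ (f , poly , sym-f) →
  no-three-distinct (f (at vP)) (f (at u)) (f (at vM))
    (separates poly sym-f vP≤1+n u≤1+n (αMatrix k≡1+2h))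
    (separates poly sym-f vM≤1+n u≤1+n (βMatrix wx≡d (sym 1+d+g≡t)) ∘ sym)
    (separates poly sym-f vP≤1+n vM≤1+n (γMatrix {h} k≡1+2h))
  where open Construction x (≤-<-trans z≤n d<t) t<k
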